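{- Let $k\ge 0$ and $n\ge 1$ be integers, let $p$ be a prime, and let $\alpha\in\mathbb{Z}$ with $\alpha\equiv 1\pmod p$. Let $\ell=\nu_p(n)$. Then \[ \sum_{i=0}^{n-1} i^{\underline{k}}\,\alpha^{i-k}\equiv \frac{(n-1)^{\underline{k}}}{k+1}\,n \pmod{p^{\ell}}. \]
   Context: For integers $m$ and $k\ge 0$, the falling factorial is $m^{\underline{k}}=m(m-1)\cdots(m-k+1)$ for $k>0$ and $m^{\underline{0}}=1$; it is $0$ when $0\le m<k$, so the terms with $i<k$ in the sum are zero. $\nu_p(n)$ is the exponent of the largest power of $p$ dividing $n$. The right-hand side is a rational number; a congruence $a\equiv b\pmod{p^\ell}$ between rationals means $a=b$ or $\nu_p(a-b)\ge \ell$, where $\nu_p(r/s)=\nu_p(r)-\nu_p(s)$. -}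

module Defs where

open import Data.Nat as ℕ using (ℕ; zero; suc; _+_; _≤_; _∸_)
open import Data.Nat.Divisibility using (_∣_)
open import Data.Integer as ℤ using (ℤ; +_)
open import Data.Rational as ℚ using (ℚ)
open import Data.List using (List; map; foldr; upTo)
open import Data.Sum using (_⊎_)
open import Relation.Nullary using (¬_)
open import Relation.Binary.PropositionalEquality using (_≡_)

fall : ℤ → ℕ → ℤ
fall m zero    = ℤ.+ 1
fall m (suc k) = fall m k ℤ.* (m ℤ.- (+ k))

HasVal : ℕ → ℕ → ℕ → Set
HasVal p x v = (p ℕ.^ v ∣ x) × ¬ (p ℕ.^ suc v ∣ x)
  where open import Data.Product using (_×_)

-- ν_p(q) ≥ ℓ for a nonzero rational q = num/den in lowest terms:
-- ν_p(q) = ν_p(num) - ν_p(den) ≥ ℓ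
ValGe : ℕ → ℚ → ℕ → Set
ValGe p q ℓ = ∀ a b → HasVal p ℤ.∣ ℚ.numerator q ∣ a → HasVal p (ℚ.denominatorℕ q) b → ℓ + b ≤ a

CongQ : ℕ → ℕ → ℚ → ℚ → Set
CongQ p ℓ a b = a ≡ b ⊎ ValGe p (a ℚ.- b) ℓ

toℚ : ℤ → ℚ
toℚ z = z ℚ./ 1

-- ∑_{i=0}^{n-1} i^{\underline k} α^{i-k}   (terms with i < k vanish since i^{\underline k} = 0)
lhsSum : ℕ → ℕ → ℤ → ℤ
lhsSum n k α = foldr ℤ._+_ (ℤ.+ 0) (map (λ i → fall (+ i) k ℤ.* (α ℤ.^ (i ∸ k))) (upTo n))

{-# OPTIONS --safe #-}
-- Write α = 1 + u with p ∣ u. After dividing by k!, the sum is Σ_{i<n} C(i,k) α^(i-k); as a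
-- polynomial in u it equals Σ_j C(k+j,k) C(n,k+1+j) u^j, since both sides satisfy Pascal's
-- recurrence in (n, k). Multiplied by k!, the j = 0 term is k!·C(n,k+1) = (n-1)(n-2)⋯(n-k)·n/(k+1),
-- so the difference of the two sides is the integer k!·Σ_{j≥1} C(k+j,k) C(n,k+1+j) u^j. Each
-- term is divisible by p^ν_p(n): writing C(n,m) = n·C(n-1,m-1)/m with m = k+1+j, the p-part of m
-- is absorbed by p^j ∣ u^j together with k!·C(k+j,k) = (j+1)(j+2)⋯(j+k).
module Submission where

open import Relation.Binary.PropositionalEquality
  using (_≡_; refl; sym; trans; cong; cong₂; subst; subst₂; module ≡-Reasoning)

module Sum where

  open import Data.Nat.Base using (ℕ; zero; suc)
  open import Data.Fin.Base using (toℕ)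
  open import Data.Fin.Properties using (toℕ-inject₁; toℕ-fromℕ)
  open import Data.Integer.Base using (ℤ; 0ℤ; _+_; _*_)
  open import Data.Integer.Properties using (+-*-semiring; +-identityʳ)
  open import Data.Integer.Divisibility.Signed using (_∣_; divides; ∣m∣n⇒∣m+n)
  open import Data.List.Base using (foldr; map; applyUpTo)
  open import Algebra.Properties.Semiring.Sum +-*-semiring
    using (sum; sum-cong-≗; ∑-distrib-+; *-distribˡ-sum; sum-init-last; sum-replicate-zero)

  Σ< : ℕ → (ℕ → ℤ) → ℤ
  Σ< n f = sum {n} (λ i → f (toℕ i))

  Σ<-cong : ∀ n {f g : ℕ → ℤ} → (∀ i → f i ≡ g i) → Σ< n f ≡ Σ< n g
  Σ<-cong n f≗g = sum-cong-≗ {n} (λ i → f≗g (toℕ i))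

  Σ<-distrib-+ : ∀ n (f g : ℕ → ℤ) → Σ< n (λ i → f i + g i) ≡ Σ< n f + Σ< n g
  Σ<-distrib-+ n f g = ∑-distrib-+ {n} (λ i → f (toℕ i)) (λ i → g (toℕ i))

  *-distribˡ-Σ< : ∀ n x (f : ℕ → ℤ) → x * Σ< n f ≡ Σ< n (λ i → x * f i)
  *-distribˡ-Σ< n x f = *-distribˡ-sum {n} x (λ i → f (toℕ i))

  Σ<-zero : ∀ n {f : ℕ → ℤ} → (∀ i → f i ≡ 0ℤ) → Σ< n f ≡ 0ℤ
  Σ<-zero n f≗0 = trans (Σ<-cong n f≗0) (sum-replicate-zero n)

  Σ<-last : ∀ n (f : ℕ → ℤ) → Σ< (suc n) f ≡ Σ< n f + f n
  Σ<-last n f = trans (sum-init-last {n} (λ i → f (toℕ i)))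
    (cong₂ _+_ (sum-cong-≗ {n} (λ i → cong f (toℕ-inject₁ i))) (cong f (toℕ-fromℕ n)))

  Σ<-reindex : ∀ M (h c : ℕ → ℤ) u → (∀ j → h (suc j) ≡ u * c j) → c M ≡ 0ℤ →
               Σ< (suc M) h ≡ h 0 + u * Σ< (suc M) c
  Σ<-reindex M h c u h[1+j]≡u*cj cM≡0 = cong (h 0 +_) (begin
    Σ< M (λ j → h (suc j))  ≡⟨ Σ<-cong M h[1+j]≡u*cj ⟩
    Σ< M (λ j → u * c j)    ≡⟨ *-distribˡ-Σ< M u c ⟨
    u * Σ< M c              ≡⟨ cong (u *_) (+-identityʳ (Σ< M c)) ⟨
    u * (Σ< M c + 0ℤ)       ≡⟨ cong (λ z → u * (Σ< M c + z)) cM≡0 ⟨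
    u * (Σ< M c + c M)      ≡⟨ cong (u *_) (Σ<-last M c) ⟨
    u * Σ< (suc M) c        ∎)
    where open ≡-Reasoning

  ∣-Σ< : ∀ n {d} {f : ℕ → ℤ} → (∀ i → d ∣ f i) → d ∣ Σ< n f
  ∣-Σ< zero    d∣f = divides 0ℤ refl
  ∣-Σ< (suc n) d∣f = ∣m∣n⇒∣m+n (d∣f 0) (∣-Σ< n (λ i → d∣f (suc i)))

  foldr-+-applyUpTo : ∀ n (g : ℕ → ℤ) (f : ℕ → ℕ) →
                      foldr _+_ 0ℤ (map g (applyUpTo f n)) ≡ Σ< n (λ i → g (f i))
  foldr-+-applyUpTo zero    g f = refl
  foldr-+-applyUpTo (suc n) g f = cong (g (f 0) +_) (foldr-+-applyUpTo n g (λ i → f (suc i)))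

module Binomial where

  open import Data.Nat.Base
  open import Data.Nat.Properties using (*-zeroʳ; *-distribˡ-+; +-assoc)
  open import Data.Nat.Combinatorics using (_C_; nCk+nC[k+1]≡[n+1]C[k+1])
  open ≡-Reasoning

  [k+1]*[n+1]C[k+1]≡[n+1]*nCk : ∀ n k → suc k * (suc n C suc k) ≡ suc n * (n C k)
  [k+1]*[n+1]C[k+1]≡[n+1]*nCk zero    zero    = refl
  [k+1]*[n+1]C[k+1]≡[n+1]*nCk zero    (suc k) = *-zeroʳ (suc (suc k))
  [k+1]*[n+1]C[k+1]≡[n+1]*nCk (suc n) k = begin
    suc k * (suc (suc n) C suc k)                  ≡⟨ cong (suc k *_) (nCk+nC[k+1]≡[n+1]C[k+1] (suc n) k) ⟨
    suc k * (suc n C k + suc n C suc k)            ≡⟨ *-distribˡ-+ (suc k) (suc n C k) _ ⟩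
    suc k * (suc n C k) + suc k * (suc n C suc k)  ≡⟨ cong (suc k * (suc n C k) +_) ([k+1]*[n+1]C[k+1]≡[n+1]*nCk n k) ⟩
    suc n C k + k * (suc n C k) + suc n * (n C k)  ≡⟨ +-assoc (suc n C k) _ _ ⟩
    suc n C k + (k * (suc n C k) + suc n * (n C k)) ≡⟨ cong (suc n C k +_) (k*[n+1]Ck+[n+1]*nCk k) ⟩
    suc n C k + suc n * (suc n C k)                ∎
    where
    k*[n+1]Ck+[n+1]*nCk : ∀ k → k * (suc n C k) + suc n * (n C k) ≡ suc n * (suc n C k)
    k*[n+1]Ck+[n+1]*nCk zero    = refl
    k*[n+1]Ck+[n+1]*nCk (suc k) = begin
      suc k * (suc n C suc k) + suc n * (n C suc k) ≡⟨ cong (_+ suc n * (n C suc k)) ([k+1]*[n+1]C[k+1]≡[n+1]*nCk n k) ⟩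
      suc n * (n C k) + suc n * (n C suc k)         ≡⟨ *-distribˡ-+ (suc n) (n C k) _ ⟨
      suc n * (n C k + n C suc k)                   ≡⟨ cong (suc n *_) (nCk+nC[k+1]≡[n+1]C[k+1] n k) ⟩
      suc n * (suc n C suc k)                       ∎

module FallingFactorial where

  open import Data.Nat.Base as ℕ using (zero; suc; _!; s≤s⁻¹)
  import Data.Nat.Properties as ℕ
  open import Algebra.Properties.CommutativeSemigroup ℕ.*-commutativeSemigroup using (x∙yz≈y∙xz)
  open import Data.Nat.Combinatorics using (_C_)
  open import Data.Integer.Base using (+_; 1ℤ; _+_; _-_; _*_; ∣_∣)
  open import Data.Integer.Properties using (pos-*; m-n≡m⊖n; ⊖-≥)
  open import Data.Integer.Tactic.RingSolver using (solve-∀)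
  open import Data.Integer.Divisibility.Signed using (_∣_; ∣-refl; ∣m⇒∣m*n; ∣n⇒∣m*n; ∣⇒∣ᵤ)
  import Data.Nat.Divisibility as ℕ
  open import Relation.Nullary using (yes; no)
  open import Defs using (fall)
  open Binomial using ([k+1]*[n+1]C[k+1]≡[n+1]*nCk)
  open ≡-Reasoning

  fall-suc : ∀ m k → fall m (suc k) ≡ m * fall (m - 1ℤ) k
  fall-suc m zero    = one-factor m
    where
    one-factor : ∀ m → 1ℤ * (m - + 0) ≡ m * 1ℤ
    one-factor = solve-∀
  fall-suc m (suc k) = begin
    fall m (suc k) * (m - + suc k)           ≡⟨ cong (_* (m - + suc k)) (fall-suc m k) ⟩
    m * fall (m - 1ℤ) k * (m - (1ℤ + + k))   ≡⟨ reassoc m (fall (m - 1ℤ) k) (+ k) ⟩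
    m * (fall (m - 1ℤ) k * (m - 1ℤ - + k))   ∎
    where
    reassoc : ∀ m f k → m * f * (m - (1ℤ + k)) ≡ m * (f * (m - 1ℤ - k))
    reassoc = solve-∀

  fall≡k!*C : ∀ i k → fall (+ i) k ≡ + (k ! ℕ.* (i C k))
  fall≡k!*C i       zero    = refl
  fall≡k!*C zero    (suc k) = trans (fall-suc (+ 0) k) (cong +_ (sym (ℕ.*-zeroʳ (suc k !))))
  fall≡k!*C (suc i) (suc k) = begin
    fall (+ suc i) (suc k)                   ≡⟨ fall-suc (+ suc i) k ⟩
    + suc i * fall (+ i) k                   ≡⟨ cong (+ suc i *_) (fall≡k!*C i k) ⟩
    + suc i * + (k ! ℕ.* (i C k))            ≡⟨ pos-* (suc i) _ ⟨
    + (suc i ℕ.* (k ! ℕ.* (i C k)))          ≡⟨ cong +_ (x∙yz≈y∙xz (suc i) (k !) _) ⟩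
    + (k ! ℕ.* (suc i ℕ.* (i C k)))          ≡⟨ cong (λ c → + (k ! ℕ.* c)) ([k+1]*[n+1]C[k+1]≡[n+1]*nCk i k) ⟨
    + (k ! ℕ.* (suc k ℕ.* (suc i C suc k)))  ≡⟨ cong +_ (trans (ℕ.*-assoc (suc k) (k !) _) (x∙yz≈y∙xz (suc k) (k !) _)) ⟨
    + (suc k ! ℕ.* (suc i C suc k))          ∎

  factor∣fall : ∀ m {t k} → t ℕ.< k → (m - + t) ∣ fall m k
  factor∣fall m {t} {suc k} t<1+k with t ℕ.≟ k
  ... | yes refl = ∣n⇒∣m*n (fall m k) ∣-refl
  ... | no  t≢k  = ∣m⇒∣m*n (m - + k) (factor∣fall m (ℕ.≤∧≢⇒< (s≤s⁻¹ t<1+k) t≢k))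

  factor∣k!*[k+J]Ck : ∀ {J k x} → J ℕ.< x → x ℕ.≤ k ℕ.+ J → x ℕ.∣ k ! ℕ.* ((k ℕ.+ J) C k)
  factor∣k!*[k+J]Ck {J} {k} {x} J<x x≤k+J =
    subst₂ ℕ._∣_ (cong ∣_∣ [k+J]-t≡x) (cong ∣_∣ (fall≡k!*C (k ℕ.+ J) k)) (∣⇒∣ᵤ (factor∣fall (+ (k ℕ.+ J)) t<k))
    where
    t = k ℕ.+ J ℕ.∸ x
    t<k : t ℕ.< k
    t<k = subst (t ℕ.<_) (ℕ.m+n∸n≡m k J) (ℕ.∸-monoʳ-< J<x x≤k+J)
    [k+J]-t≡x : + (k ℕ.+ J) - + t ≡ + x
    [k+J]-t≡x = trans (m-n≡m⊖n (k ℕ.+ J) t) (trans (⊖-≥ (ℕ.m∸n≤m (k ℕ.+ J) x)) (cong +_ (ℕ.m∸[m∸n]≡n x≤k+J)))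

module BinomialExpansion where

  open import Data.Nat.Base as ℕ using (ℕ; zero; suc; _∸_; s≤s)
  import Data.Nat.Properties as ℕ
  open import Data.Nat.Combinatorics using (_C_; nCk+nC[k+1]≡[n+1]C[k+1]; k>n⇒nCk≡0; nCn≡1)
  open import Data.Integer.Base using (ℤ; +_; 0ℤ; 1ℤ; _+_; _*_; _^_)
  open import Data.Integer.Properties using (pos-+; +-identityˡ; +-identityʳ; *-identityˡ; *-identityʳ; *-zeroʳ)
  open import Data.Integer.Tactic.RingSolver using (solve-∀)
  open import Relation.Nullary using (Dec; yes; no)
  open Sum
  open ≡-Reasoning

  +-pascal : ∀ n k → + (n C k) + + (n C suc k) ≡ + (suc n C suc k)
  +-pascal n k = trans (sym (pos-+ (n C k) _)) (cong +_ (nCk+nC[k+1]≡[n+1]C[k+1] n k))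

  binomialSum : ℕ → ℕ → ℤ → ℤ
  binomialSum n k α = Σ< n (λ i → + (i C k) * α ^ (i ∸ k))

  binomialSum-suc-zero : ∀ n α → binomialSum (suc n) 0 α ≡ 1ℤ + α * binomialSum n 0 α
  binomialSum-suc-zero n α = cong (_+_ 1ℤ)
    (trans (Σ<-cong n (λ i → swap α (α ^ i))) (sym (*-distribˡ-Σ< n α (λ i → 1ℤ * α ^ i))))
    where
    swap : ∀ α y → 1ℤ * (α * y) ≡ α * (1ℤ * y)
    swap = solve-∀

  binomialSum-suc-suc : ∀ n k α → binomialSum (suc n) (suc k) α ≡ binomialSum n k α + α * binomialSum n (suc k) α
  binomialSum-suc-suc n k α = begin
    0ℤ + Σ< n (λ i → + (suc i C suc k) * α ^ (i ∸ k))                ≡⟨ +-identityˡ _ ⟩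
    Σ< n (λ i → + (suc i C suc k) * α ^ (i ∸ k))                     ≡⟨ Σ<-cong n pascal-step ⟩
    Σ< n (λ i → + (i C k) * α ^ (i ∸ k) + α * (+ (i C suc k) * α ^ (i ∸ suc k)))
                                                                      ≡⟨ Σ<-distrib-+ n (λ i → + (i C k) * α ^ (i ∸ k)) (λ i → α * (+ (i C suc k) * α ^ (i ∸ suc k))) ⟩
    binomialSum n k α + Σ< n (λ i → α * (+ (i C suc k) * α ^ (i ∸ suc k)))
                                                                      ≡⟨ cong (_+_ (binomialSum n k α)) (*-distribˡ-Σ< n α (λ i → + (i C suc k) * α ^ (i ∸ suc k))) ⟨
    binomialSum n k α + α * binomialSum n (suc k) α                  ∎
    where
    pascal-step : ∀ i → + (suc i C suc k) * α ^ (i ∸ k) ≡ + (i C k) * α ^ (i ∸ k) + α * (+ (i C suc k) * α ^ (i ∸ suc k))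
    pascal-step i = trans (cong (_* α ^ (i ∸ k)) (sym (+-pascal i k))) (split (i ℕ.≤? k))
      where
      a = + (i C k)
      b = + (i C suc k)
      split : Dec (i ℕ.≤ k) → (a + b) * α ^ (i ∸ k) ≡ a * α ^ (i ∸ k) + α * (b * α ^ (i ∸ suc k))
      split (yes i≤k) = begin
        (a + b) * α ^ (i ∸ k)                          ≡⟨ cong (λ c → (a + + c) * α ^ (i ∸ k)) iC[k+1]≡0 ⟩
        (a + 0ℤ) * α ^ (i ∸ k)                         ≡⟨ cong (_* α ^ (i ∸ k)) (+-identityʳ a) ⟩
        a * α ^ (i ∸ k)                                ≡⟨ +-identityʳ _ ⟨
        a * α ^ (i ∸ k) + 0ℤ                           ≡⟨ cong (_+_ (a * α ^ (i ∸ k))) (*-zeroʳ α) ⟨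
        a * α ^ (i ∸ k) + α * (0ℤ * α ^ (i ∸ suc k))   ≡⟨ cong (λ c → a * α ^ (i ∸ k) + α * (+ c * α ^ (i ∸ suc k))) iC[k+1]≡0 ⟨
        a * α ^ (i ∸ k) + α * (b * α ^ (i ∸ suc k))    ∎
        where
        iC[k+1]≡0 : i C suc k ≡ 0
        iC[k+1]≡0 = k>n⇒nCk≡0 (s≤s i≤k)
      split (no i≰k) = begin
        (a + b) * α ^ (i ∸ k)                      ≡⟨ cong (λ e → (a + b) * α ^ e) (ℕ.+-∸-assoc 1 (ℕ.≰⇒> i≰k)) ⟩
        (a + b) * (α * α ^ (i ∸ suc k))             ≡⟨ distribute α a b (α ^ (i ∸ suc k)) ⟩
        a * (α * α ^ (i ∸ suc k)) + α * (b * α ^ (i ∸ suc k)) ≡⟨ cong (λ e → a * α ^ e + α * (b * α ^ (i ∸ suc k))) (ℕ.+-∸-assoc 1 (ℕ.≰⇒> i≰k)) ⟨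
        a * α ^ (i ∸ k) + α * (b * α ^ (i ∸ suc k)) ∎
        where
        distribute : ∀ α a b y → (a + b) * (α * y) ≡ a * (α * y) + α * (b * y)
        distribute = solve-∀

  -- The terms with k + j ≥ n vanish, so any M ≥ n gives the same sum; fixing M keeps the
  -- range of summation independent of n in the induction below.
  expansionTerm : ℕ → ℕ → ℤ → ℕ → ℤ
  expansionTerm n k u j = + ((k ℕ.+ j) C k) * + (n C suc (k ℕ.+ j)) * u ^ j

  expansion : ℕ → ℕ → ℕ → ℤ → ℤ
  expansion M n k u = Σ< (suc M) (expansionTerm n k u)

  expansion-zero : ∀ M k u → expansion M 0 k u ≡ 0ℤ
  expansion-zero M k u = Σ<-zero (suc M) (λ j → cong (_* u ^ j) (*-zeroʳ (+ ((k ℕ.+ j) C k))))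

  expansion-suc-zero : ∀ {M n} u → n ℕ.≤ M → expansion M (suc n) 0 u ≡ 1ℤ + (1ℤ + u) * expansion M n 0 u
  expansion-suc-zero {M} {n} u n≤M = begin
    expansion M (suc n) 0 u                  ≡⟨ Σ<-cong (suc M) pascal-step ⟩
    Σ< (suc M) (λ j → h j + t j)             ≡⟨ Σ<-distrib-+ (suc M) h t ⟩
    Σ< (suc M) h + E                         ≡⟨ cong (_+ E) (Σ<-reindex M h t u h[1+j]≡u*tj tM≡0) ⟩
    1ℤ + u * E + E                           ≡⟨ regroup u E ⟩
    1ℤ + (1ℤ + u) * E                        ∎
    where
    t = expansionTerm n 0 u
    E = expansion M n 0 u
    h : ℕ → ℤ
    h j = + (n C j) * u ^ j
    pascal-step : ∀ j → expansionTerm (suc n) 0 u j ≡ h j + t j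
    pascal-step j = trans (cong (λ c → 1ℤ * c * u ^ j) (sym (+-pascal n j))) (distribute (+ (n C j)) (+ (n C suc j)) (u ^ j))
      where
      distribute : ∀ a b y → 1ℤ * (a + b) * y ≡ a * y + 1ℤ * b * y
      distribute = solve-∀
    h[1+j]≡u*tj : ∀ j → h (suc j) ≡ u * t j
    h[1+j]≡u*tj j = reassoc u (+ (n C suc j)) (u ^ j)
      where
      reassoc : ∀ u c y → c * (u * y) ≡ u * (1ℤ * c * y)
      reassoc = solve-∀
    tM≡0 : t M ≡ 0ℤ
    tM≡0 = cong (λ c → 1ℤ * + c * u ^ M) (k>n⇒nCk≡0 (s≤s n≤M))
    regroup : ∀ u E → 1ℤ + u * E + E ≡ 1ℤ + (1ℤ + u) * E
    regroup = solve-∀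

  expansion-suc-suc : ∀ {M n} k u → n ℕ.≤ M →
                      expansion M (suc n) (suc k) u ≡ expansion M n k u + (1ℤ + u) * expansion M n (suc k) u
  expansion-suc-suc {M} {n} k u n≤M = begin
    expansion M (suc n) (suc k) u                ≡⟨ Σ<-cong (suc M) pascal-step ⟩
    Σ< (suc M) (λ j → s j + (t j + h j))         ≡⟨ Σ<-distrib-+ (suc M) s (λ j → t j + h j) ⟩
    Σ< (suc M) s + Σ< (suc M) (λ j → t j + h j)  ≡⟨ cong (_+_ E₀) (Σ<-distrib-+ (suc M) t h) ⟩
    E₀ + (E₁ + Σ< (suc M) h)                     ≡⟨ cong (λ z → E₀ + (E₁ + z)) (Σ<-reindex M h t u h[1+j]≡u*tj tM≡0) ⟩
    E₀ + (E₁ + (h 0 + u * E₁))                   ≡⟨ cong (λ z → E₀ + (E₁ + (z + u * E₁))) h0≡0 ⟩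
    E₀ + (E₁ + (0ℤ + u * E₁))                    ≡⟨ regroup u E₀ E₁ ⟩
    E₀ + (1ℤ + u) * E₁                           ∎
    where
    s = expansionTerm n k u
    t = expansionTerm n (suc k) u
    E₀ = expansion M n k u
    E₁ = expansion M n (suc k) u
    h : ℕ → ℤ
    h j = + ((k ℕ.+ j) C suc k) * + (n C suc (k ℕ.+ j)) * u ^ j
    pascal-step : ∀ j → expansionTerm (suc n) (suc k) u j ≡ s j + (t j + h j)
    pascal-step j = begin
      A * + (suc n C suc (suc (k ℕ.+ j))) * u ^ j   ≡⟨ cong (λ c → A * c * u ^ j) (+-pascal n (suc (k ℕ.+ j))) ⟨
      A * (b₀ + b₁) * u ^ j                          ≡⟨ cong (λ c → c * (b₀ + b₁) * u ^ j) (+-pascal (k ℕ.+ j) k) ⟨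
      (a₀ + a₁) * (b₀ + b₁) * u ^ j                  ≡⟨ distribute a₀ a₁ b₀ b₁ (u ^ j) ⟩
      a₀ * b₀ * u ^ j + ((a₀ + a₁) * b₁ * u ^ j + a₁ * b₀ * u ^ j)
                                                      ≡⟨ cong (λ c → a₀ * b₀ * u ^ j + (c * b₁ * u ^ j + a₁ * b₀ * u ^ j)) (+-pascal (k ℕ.+ j) k) ⟩
      s j + (t j + h j)                              ∎
      where
      A = + (suc (k ℕ.+ j) C suc k)
      a₀ = + ((k ℕ.+ j) C k)
      a₁ = + ((k ℕ.+ j) C suc k)
      b₀ = + (n C suc (k ℕ.+ j))
      b₁ = + (n C suc (suc (k ℕ.+ j)))
      distribute : ∀ a₀ a₁ b₀ b₁ y → (a₀ + a₁) * (b₀ + b₁) * y ≡ a₀ * b₀ * y + ((a₀ + a₁) * b₁ * y + a₁ * b₀ * y)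
      distribute = solve-∀
    h[1+j]≡u*tj : ∀ j → h (suc j) ≡ u * t j
    h[1+j]≡u*tj j = trans (cong (λ i → + (i C suc k) * + (n C suc i) * u ^ suc j) (ℕ.+-suc k j))
                          (reassoc u (+ (suc (k ℕ.+ j) C suc k)) (+ (n C suc (suc (k ℕ.+ j)))) (u ^ j))
      where
      reassoc : ∀ u a b y → a * b * (u * y) ≡ u * (a * b * y)
      reassoc = solve-∀
    tM≡0 : t M ≡ 0ℤ
    tM≡0 = trans (cong (λ c → + (suc (k ℕ.+ M) C suc k) * + c * u ^ M)
                       (k>n⇒nCk≡0 (s≤s (ℕ.≤-trans n≤M (ℕ.≤-trans (ℕ.m≤n+m M k) (ℕ.n≤1+n _))))))
                 (cong (_* u ^ M) (*-zeroʳ (+ (suc (k ℕ.+ M) C suc k))))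
    h0≡0 : h 0 ≡ 0ℤ
    h0≡0 = cong (λ c → + c * + (n C suc (k ℕ.+ 0)) * 1ℤ) (k>n⇒nCk≡0 (s≤s (ℕ.≤-reflexive (ℕ.+-identityʳ k))))
    regroup : ∀ u E₀ E₁ → E₀ + (E₁ + (0ℤ + u * E₁)) ≡ E₀ + (1ℤ + u) * E₁
    regroup = solve-∀

  binomialSum≡expansion : ∀ M n k u → n ℕ.≤ M → binomialSum n k (1ℤ + u) ≡ expansion M n k u
  binomialSum≡expansion M zero    k       u _   = sym (expansion-zero M k u)
  binomialSum≡expansion M (suc n) zero    u n<M = begin
    binomialSum (suc n) 0 (1ℤ + u)                 ≡⟨ binomialSum-suc-zero n (1ℤ + u) ⟩
    1ℤ + (1ℤ + u) * binomialSum n 0 (1ℤ + u)       ≡⟨ cong (λ z → 1ℤ + (1ℤ + u) * z) (binomialSum≡expansion M n 0 u n≤M) ⟩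
    1ℤ + (1ℤ + u) * expansion M n 0 u              ≡⟨ expansion-suc-zero u n≤M ⟨
    expansion M (suc n) 0 u                        ∎
    where n≤M = ℕ.<⇒≤ n<M
  binomialSum≡expansion M (suc n) (suc k) u n<M = begin
    binomialSum (suc n) (suc k) (1ℤ + u)           ≡⟨ binomialSum-suc-suc n k (1ℤ + u) ⟩
    binomialSum n k (1ℤ + u) + (1ℤ + u) * binomialSum n (suc k) (1ℤ + u)
                                                   ≡⟨ cong₂ (λ a b → a + (1ℤ + u) * b) (binomialSum≡expansion M n k u n≤M)
                                                                                        (binomialSum≡expansion M n (suc k) u n≤M) ⟩
    expansion M n k u + (1ℤ + u) * expansion M n (suc k) u
                                                   ≡⟨ expansion-suc-suc k u n≤M ⟨
    expansion M (suc n) (suc k) u                  ∎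
    where n≤M = ℕ.<⇒≤ n<M

  expansionTerm-zero : ∀ n k u → expansionTerm n k u 0 ≡ + (n C suc k)
  expansionTerm-zero n k u = begin
    + ((k ℕ.+ 0) C k) * + (n C suc (k ℕ.+ 0)) * 1ℤ  ≡⟨ *-identityʳ _ ⟩
    + ((k ℕ.+ 0) C k) * + (n C suc (k ℕ.+ 0))       ≡⟨ cong (λ i → + (i C k) * + (n C suc i)) (ℕ.+-identityʳ k) ⟩
    + (k C k) * + (n C suc k)                       ≡⟨ cong (λ c → + c * + (n C suc k)) (nCn≡1 k) ⟩
    1ℤ * + (n C suc k)                              ≡⟨ *-identityˡ _ ⟩
    + (n C suc k)                                   ∎

module IntegerPower where

  import Data.Nat.Base as ℕ
  open import Data.Nat.Base using (zero; suc)
  open import Data.Integer.Base using (+_; _*_; _^_)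
  open import Data.Integer.Properties using (pos-*)
  open import Data.Integer.Divisibility.Signed using (_∣_; ∣-refl; ∣-trans; *-monoʳ-∣; *-monoˡ-∣)

  pos-^ : ∀ m n → + (m ℕ.^ n) ≡ (+ m) ^ n
  pos-^ m zero    = refl
  pos-^ m (suc n) = trans (pos-* m (m ℕ.^ n)) (cong (+ m *_) (pos-^ m n))

  ^-monoˡ-∣ : ∀ {a b} n → a ∣ b → a ^ n ∣ b ^ n
  ^-monoˡ-∣ zero    a∣b = ∣-refl
  ^-monoˡ-∣ {a} {b} (suc n) a∣b = ∣-trans (*-monoˡ-∣ (a ^ n) a∣b) (*-monoʳ-∣ b (^-monoˡ-∣ n a∣b))

module PrimePower where

  open import Data.Nat.Base
  open import Data.Nat.Properties
  open import Data.Nat.Divisibility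
  open import Data.Nat.Primality using (Prime; euclidsLemma; prime⇒nonZero)
  open import Data.Nat.Induction using (<-wellFounded)
  open import Induction.WellFounded using (Acc; acc)
  open import Data.Product using (∃₂; _×_; _,_)
  open import Data.Sum using (inj₁; inj₂)
  open import Relation.Nullary using (¬_; yes; no; contradiction)
  open import Algebra.Properties.CommutativeSemigroup *-commutativeSemigroup using (x∙yz≈y∙xz)

  ^-monoʳ-∣ : ∀ m {i j} → i ≤ j → m ^ i ∣ m ^ j
  ^-monoʳ-∣ m {i} {j} i≤j = divides (m ^ (j ∸ i)) (begin
    m ^ j                ≡⟨ cong (m ^_) (m+[n∸m]≡n i≤j) ⟨
    m ^ (i + (j ∸ i))    ≡⟨ ^-distribˡ-+-* m i (j ∸ i) ⟩
    m ^ i * m ^ (j ∸ i)  ≡⟨ *-comm (m ^ i) _ ⟩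
    m ^ (j ∸ i) * m ^ i  ∎)
    where open ≡-Reasoning

  n<m^n : ∀ {m} → 1 < m → ∀ n → n < m ^ n
  n<m^n 1<m zero        = s≤s z≤n
  n<m^n {m} 1<m (suc n) = begin-strict
    suc n            <⟨ m<m+n (suc n) (s≤s z≤n) ⟩
    suc n + suc n    ≤⟨ +-mono-≤ (n<m^n 1<m n) (n<m^n 1<m n) ⟩
    m ^ n + m ^ n    ≡⟨ cong (m ^ n +_) (+-identityʳ (m ^ n)) ⟨
    2 * m ^ n        ≤⟨ *-monoˡ-≤ (m ^ n) 1<m ⟩
    m * m ^ n        ∎
    where open ≤-Reasoning

  split-prime-power : ∀ {p} → 1 < p → ∀ m → .{{NonZero m}} → ∃₂ λ e r → m ≡ p ^ e * r × ¬ p ∣ r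
  split-prime-power {p} 1<p m = go m (<-wellFounded m)
    where
    go : ∀ m → .{{NonZero m}} → Acc _<_ m → ∃₂ λ e r → m ≡ p ^ e * r × ¬ p ∣ r
    go m (acc smaller) with p ∣? m
    ... | no  p∤m = 0 , m , sym (*-identityˡ m) , p∤m
    ... | yes (divides q refl) with go q {{q≢0}} (smaller (m<m*n q p 1<p))
      where instance q≢0 = m*n≢0⇒m≢0 q
    ... | e , r , q≡pᵉr , p∤r = suc e , r , trans (cong (_* p) q≡pᵉr) (shift (p ^ e) r) , p∤r
      where
      shift : ∀ a r → a * r * p ≡ p * a * r
      shift a r = trans (*-comm (a * r) p) (sym (*-assoc p a r))

  p^a∣m*r⇒p^a∣m : ∀ {p r} → Prime p → ¬ p ∣ r → ∀ a m → p ^ a ∣ m * r → p ^ a ∣ m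
  p^a∣m*r⇒p^a∣m _ _ zero m _ = 1∣ m
  p^a∣m*r⇒p^a∣m {p} {r} p-prime p∤r (suc a) m p^[1+a]∣mr
    with euclidsLemma m r p-prime (∣-trans (m∣m*n (p ^ a)) p^[1+a]∣mr)
  ... | inj₂ p∣r = contradiction p∣r p∤r
  ... | inj₁ (divides q refl) = subst (p * p ^ a ∣_) (*-comm p q) (*-monoʳ-∣ p p^a∣q)
    where
    p^a∣q : p ^ a ∣ q
    p^a∣q = p^a∣m*r⇒p^a∣m p-prime p∤r a q
      (*-cancelˡ-∣ p {{prime⇒nonZero p-prime}} (subst (p * p ^ a ∣_) (trans (*-assoc q p r) (x∙yz≈y∙xz q p r)) p^[1+a]∣mr))

module TermDivisibility where

  open import Data.Nat.Base
  open import Data.Nat.Properties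
  open import Data.Nat.Divisibility
  open import Data.Nat.Combinatorics using (_C_)
  open import Data.Nat.Primality using (Prime; prime⇒nonTrivial; prime⇒nonZero)
  open import Data.Nat.Tactic.RingSolver using (solve-∀)
  open import Data.Product using (∃₂; _×_; _,_)
  open import Relation.Nullary using (¬_; yes; no)
  open import Algebra.Properties.CommutativeSemigroup *-commutativeSemigroup using (x∙yz≈y∙xz)
  open Binomial using ([k+1]*[n+1]C[k+1]≡[n+1]*nCk)
  open FallingFactorial using (factor∣k!*[k+J]Ck)
  open PrimePower

  -- If e > J then B = p^(e-J) divides m - B, which lies in (J, k + J] and hence is one of the
  -- factors J + 1, …, J + k of k!·C(k+J,k).
  p^e∣[k+J+1]⇒p^e∣k!*[k+J]Ck*p^J : ∀ {p} → 1 < p → ∀ {k J e} → 0 < J → p ^ e ∣ suc (k + J) →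
                                    p ^ e ∣ k ! * ((k + J) C k) * p ^ J
  p^e∣[k+J+1]⇒p^e∣k!*[k+J]Ck*p^J {p} 1<p {k} {J} {e} 0<J p^e∣m with e ≤? J
  ... | yes e≤J = ∣-trans (^-monoʳ-∣ p e≤J) (n∣m*n (k ! * ((k + J) C k)))
  ... | no  e≰J = subst (_∣ k ! * ((k + J) C k) * p ^ J) (sym p^e≡B*p^J) (*-monoˡ-∣ (p ^ J) B∣k!*[k+J]Ck)
    where
    m = suc (k + J)
    J<e : J < e
    J<e = ≰⇒> e≰J
    B = p ^ (e ∸ J)
    p^e≡B*p^J : p ^ e ≡ B * p ^ J
    p^e≡B*p^J = trans (cong (p ^_) (sym (m∸n+n≡m (<⇒≤ J<e)))) (^-distribˡ-+-* p (e ∸ J) J)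
    1<B : 1 < B
    1<B = ≤-<-trans (m<n⇒0<n∸m J<e) (n<m^n 1<p (e ∸ J))
    B∣m : B ∣ m
    B∣m = ∣-trans (m∣m*n (p ^ J)) (subst (_∣ m) p^e≡B*p^J p^e∣m)
    1+J+B≤m : suc J + B ≤ m
    1+J+B≤m = begin
      suc J + B      ≡⟨ +-comm (suc J) B ⟩
      B + suc J      ≤⟨ +-monoʳ-≤ B (+-monoˡ-≤ J 0<J) ⟩
      B + (J + J)    ≡⟨ cong (λ j → B + (J + j)) (+-identityʳ J) ⟨
      B + 2 * J      ≤⟨ +-monoʳ-≤ B (*-monoˡ-≤ J 1<B) ⟩
      B + B * J      ≡⟨ *-suc B J ⟨
      B * suc J      ≤⟨ *-monoʳ-≤ B (n<m^n 1<p J) ⟩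
      B * p ^ J      ≡⟨ p^e≡B*p^J ⟨
      p ^ e          ≤⟨ ∣⇒≤ p^e∣m ⟩
      m              ∎
      where open ≤-Reasoning
    B≤m : B ≤ m
    B≤m = ≤-trans (m≤n+m B (suc J)) 1+J+B≤m
    B∣m∸B : B ∣ m ∸ B
    B∣m∸B = ∣m+n∣m⇒∣n (subst (B ∣_) (sym (m+[n∸m]≡n B≤m)) B∣m) ∣-refl
    B∣k!*[k+J]Ck : B ∣ k ! * ((k + J) C k)
    B∣k!*[k+J]Ck = ∣-trans B∣m∸B (factor∣k!*[k+J]Ck (m+n≤o⇒m≤o∸n (suc J) 1+J+B≤m) (∸-monoʳ-≤ m (<⇒≤ 1<B)))

  p^ℓ∣[n+1]⇒p^ℓ∣k!*[k+J]Ck*[n+1]C[k+J+1]*p^J :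
    ∀ {p ℓ n k J} → Prime p → p ^ ℓ ∣ suc n → 0 < J →
    p ^ ℓ ∣ k ! * ((k + J) C k) * (suc n C suc (k + J)) * p ^ J
  p^ℓ∣[n+1]⇒p^ℓ∣k!*[k+J]Ck*[n+1]C[k+J+1]*p^J {p} {ℓ} {n} {k} {J} p-prime p^ℓ∣n 0<J =
    cancel-p-free-part (split-prime-power 1<p m)
    where
    instance
      p≢0 = prime⇒nonZero p-prime
    1<p : 1 < p
    1<p = nonTrivial⇒n>1 p {{prime⇒nonTrivial p-prime}}
    m = suc (k + J)
    F = k ! * ((k + J) C k)
    X = F * (suc n C m) * p ^ J
    X*m≡F*p^J*[[n+1]*nC[k+J]] : X * m ≡ F * p ^ J * (suc n * (n C (k + J)))
    X*m≡F*p^J*[[n+1]*nC[k+J]] =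
      trans (regroup F (suc n C m) (p ^ J) m) (cong (F * p ^ J *_) ([k+1]*[n+1]C[k+1]≡[n+1]*nCk n (k + J)))
      where
      regroup : ∀ f c q m → f * c * q * m ≡ f * q * (m * c)
      regroup = solve-∀
    cancel-p-free-part : (∃₂ λ e r → m ≡ p ^ e * r × ¬ p ∣ r) → p ^ ℓ ∣ X
    cancel-p-free-part (e , r , m≡p^e*r , p∤r) =
      p^a∣m*r⇒p^a∣m p-prime p∤r ℓ X (*-cancelˡ-∣ (p ^ e) {{m^n≢0 p e}} (subst (p ^ e * p ^ ℓ ∣_) X*m≡p^e*[X*r] p^e*p^ℓ∣X*m))
      where
      X*m≡p^e*[X*r] : X * m ≡ p ^ e * (X * r)
      X*m≡p^e*[X*r] = trans (cong (X *_) m≡p^e*r) (x∙yz≈y∙xz X (p ^ e) r)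
      p^e∣m : p ^ e ∣ m
      p^e∣m = subst (p ^ e ∣_) (sym m≡p^e*r) (m∣m*n r)
      p^e*p^ℓ∣X*m : p ^ e * p ^ ℓ ∣ X * m
      p^e*p^ℓ∣X*m = subst (p ^ e * p ^ ℓ ∣_) (sym X*m≡F*p^J*[[n+1]*nC[k+J]])
        (*-pres-∣ (p^e∣[k+J+1]⇒p^e∣k!*[k+J]Ck*p^J 1<p {k} {J} {e} 0<J p^e∣m) (∣m⇒∣m*n (n C (k + J)) p^ℓ∣n))

module RationalEmbedding where

  open import Data.Nat.Base as ℕ using (zero; suc; _^_; _<_; _≤_; _+_)
  import Data.Nat.Properties as ℕ
  open import Data.Nat.Divisibility using (_∣_; ∣-trans; m∣m*n; ∣1⇒≡1)
  open import Data.Nat.Coprimality using (1-coprimeTo) renaming (sym to coprime-sym)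
  open import Data.Integer.Base as ℤ using (+_; ∣_∣)
  open import Data.Integer.Tactic.RingSolver using (solve-∀)
  open import Data.Rational.Base as ℚ using (mkℚ)
  import Data.Rational.Properties as ℚ
  open import Data.Rational.Unnormalised.Base as ℚᵘ using (mkℚᵘ; *≡*)
  import Data.Rational.Unnormalised.Properties as ℚᵘ
  open import Data.Product using (_,_)
  open import Relation.Nullary using (contradiction)
  open import Defs using (toℚ; HasVal; ValGe)
  open PrimePower using (^-monoʳ-∣)

  toℚ-sub-/ : ∀ a b k → toℚ a ℚ.- (+ suc k ℤ.* b) ℚ./ suc k ≡ toℚ (a ℤ.- b)
  toℚ-sub-/ a b k = ℚ.toℚᵘ-injective (begin
    ℚ.toℚᵘ (toℚ a ℚ.+ ℚ.- y)                  ≈⟨ ℚ.toℚᵘ-homo-+ (toℚ a) (ℚ.- y) ⟩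
    ℚ.toℚᵘ (toℚ a) ℚᵘ.+ ℚ.toℚᵘ (ℚ.- y)         ≈⟨ ℚᵘ.+-cong (ℚ.toℚᵘ-fromℚᵘ (mkℚᵘ a 0))
                                                    (ℚᵘ.≃-trans (ℚ.toℚᵘ-homo‿- y) (ℚᵘ.-‿cong (ℚ.toℚᵘ-fromℚᵘ (mkℚᵘ K*b k)))) ⟩
    mkℚᵘ a 0 ℚᵘ.+ ℚᵘ.- mkℚᵘ K*b k              ≈⟨ *≡* (trans (cross a b (+ suc k)) (cong (λ d → (a ℤ.- b) ℤ.* + suc d) (sym (ℕ.+-identityʳ k)))) ⟩
    mkℚᵘ (a ℤ.- b) 0                            ≈⟨ ℚ.toℚᵘ-fromℚᵘ (mkℚᵘ (a ℤ.- b) 0) ⟨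
    ℚ.toℚᵘ (toℚ (a ℤ.- b))                      ∎)
    where
    open ℚᵘ.≃-Reasoning
    K*b = + suc k ℤ.* b
    y = K*b ℚ./ suc k
    cross : ∀ a b K → (a ℤ.* K ℤ.+ ℤ.- (K ℤ.* b) ℤ.* ℤ.1ℤ) ℤ.* ℤ.1ℤ ≡ (a ℤ.- b) ℤ.* K
    cross = solve-∀

  hasVal-≤ : ∀ {p x a ℓ} → HasVal p x a → p ^ ℓ ∣ x → ℓ ≤ a
  hasVal-≤ {p} (_ , p^[1+a]∤x) p^ℓ∣x = ℕ.≮⇒≥ (λ a<ℓ → p^[1+a]∤x (∣-trans (^-monoʳ-∣ p a<ℓ) p^ℓ∣x))

  hasVal-1 : ∀ {p b} → 1 < p → HasVal p 1 b → b ≡ 0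
  hasVal-1 {b = zero}  _   _            = refl
  hasVal-1 {p} {suc b} 1<p (p^[1+b]∣1 , _) = contradiction (∣1⇒≡1 (∣-trans (m∣m*n (p ^ b)) p^[1+b]∣1)) (ℕ.>⇒≢ 1<p)

  valGe-toℚ : ∀ {p ℓ} → 1 < p → ∀ D → p ^ ℓ ∣ ∣ D ∣ → ValGe p (toℚ D) ℓ
  valGe-toℚ {p} {ℓ} 1<p D p^ℓ∣D = subst (λ q → ValGe p q ℓ) (sym (ℚ.↥p/↧p≡p D/1)) valGe-D/1
    where
    D/1 = mkℚ D 0 (coprime-sym (1-coprimeTo ∣ D ∣))
    valGe-D/1 : ValGe p D/1 ℓ
    valGe-D/1 a b hasVal-a hasVal-b = ℕ.≤-trans (ℕ.≤-reflexive ℓ+b≡ℓ) (hasVal-≤ hasVal-a p^ℓ∣D)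
      where
      ℓ+b≡ℓ : ℓ + b ≡ ℓ
      ℓ+b≡ℓ = trans (cong (_+_ ℓ) (hasVal-1 1<p hasVal-b)) (ℕ.+-identityʳ ℓ)

module FallingFactorialSum where

  open import Data.Nat.Base as ℕ using (suc; _∸_; _!; s≤s; z≤n)
  import Data.Nat.Properties as ℕ
  import Data.Nat.Divisibility as ℕ
  open import Data.Nat.Combinatorics using (_C_)
  open import Data.Nat.Primality using (Prime)
  open import Data.Integer.Base using (+_; 1ℤ; _+_; _-_; _*_; _^_; ∣_∣)
  open import Data.Integer.Properties using (pos-*; *-assoc)
  open import Data.Integer.Tactic.RingSolver using (solve-∀)
  open import Data.Integer.Divisibility.Signed using (_∣_; ∣-trans; *-monoʳ-∣; ∣ᵤ⇒∣; ∣⇒∣ᵤ)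
  open import Algebra.Properties.CommutativeSemigroup ℕ.*-commutativeSemigroup using (x∙yz≈y∙xz)
  open import Defs using (fall; lhsSum)
  open Sum
  open IntegerPower
  open Binomial using ([k+1]*[n+1]C[k+1]≡[n+1]*nCk)
  open FallingFactorial using (fall≡k!*C)
  open TermDivisibility using (p^ℓ∣[n+1]⇒p^ℓ∣k!*[k+J]Ck*[n+1]C[k+J+1]*p^J)
  open BinomialExpansion
  open ≡-Reasoning

  lhsSum≡k!*binomialSum : ∀ n k α → lhsSum n k α ≡ + (k !) * binomialSum n k α
  lhsSum≡k!*binomialSum n k α = begin
    lhsSum n k α                                         ≡⟨ foldr-+-applyUpTo n (λ i → fall (+ i) k * α ^ (i ∸ k)) (λ i → i) ⟩
    Σ< n (λ i → fall (+ i) k * α ^ (i ∸ k))              ≡⟨ Σ<-cong n term≡ ⟩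
    Σ< n (λ i → + (k !) * (+ (i C k) * α ^ (i ∸ k)))     ≡⟨ *-distribˡ-Σ< n (+ (k !)) (λ i → + (i C k) * α ^ (i ∸ k)) ⟨
    + (k !) * binomialSum n k α                          ∎
    where
    term≡ : ∀ i → fall (+ i) k * α ^ (i ∸ k) ≡ + (k !) * (+ (i C k) * α ^ (i ∸ k))
    term≡ i = trans (cong (_* α ^ (i ∸ k)) (trans (fall≡k!*C i k) (pos-* (k !) (i C k)))) (*-assoc (+ (k !)) _ _)

  fall*[n+1]≡[k+1]*k!*[n+1]C[k+1] : ∀ n k → fall (+ n) k * + suc n ≡ + suc k * + (k ! ℕ.* (suc n C suc k))
  fall*[n+1]≡[k+1]*k!*[n+1]C[k+1] n k = begin
    fall (+ n) k * + suc n                    ≡⟨ cong (_* + suc n) (fall≡k!*C n k) ⟩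
    + (k ! ℕ.* (n C k)) * + suc n             ≡⟨ pos-* (k ! ℕ.* (n C k)) (suc n) ⟨
    + (k ! ℕ.* (n C k) ℕ.* suc n)             ≡⟨ cong +_ (trans (ℕ.*-assoc (k !) (n C k) (suc n)) (cong (k ! ℕ.*_) (ℕ.*-comm (n C k) (suc n)))) ⟩
    + (k ! ℕ.* (suc n ℕ.* (n C k)))           ≡⟨ cong (λ c → + (k ! ℕ.* c)) ([k+1]*[n+1]C[k+1]≡[n+1]*nCk n k) ⟨
    + (k ! ℕ.* (suc k ℕ.* (suc n C suc k)))   ≡⟨ cong +_ (x∙yz≈y∙xz (k !) (suc k) _) ⟩
    + (suc k ℕ.* (k ! ℕ.* (suc n C suc k)))   ≡⟨ pos-* (suc k) _ ⟩
    + suc k * + (k ! ℕ.* (suc n C suc k))     ∎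

  lhsSum-k!*[n+1]C[k+1]≡Σk!*expansionTerm : ∀ n k u → lhsSum (suc n) k (1ℤ + u) - + (k ! ℕ.* (suc n C suc k))
                                    ≡ Σ< (suc n) (λ j → + (k !) * expansionTerm (suc n) k u (suc j))
  lhsSum-k!*[n+1]C[k+1]≡Σk!*expansionTerm n k u = begin
    lhsSum (suc n) k (1ℤ + u) - + (k ! ℕ.* c)                   ≡⟨ cong₂ _-_ (lhsSum≡k!*binomialSum (suc n) k (1ℤ + u)) (pos-* (k !) c) ⟩
    + (k !) * binomialSum (suc n) k (1ℤ + u) - + (k !) * + c   ≡⟨ cong (λ s → + (k !) * s - + (k !) * + c) (binomialSum≡expansion (suc n) (suc n) k u ℕ.≤-refl) ⟩
    + (k !) * (expansionTerm (suc n) k u 0 + S) - + (k !) * + c ≡⟨ cong (λ t → + (k !) * (t + S) - + (k !) * + c) (expansionTerm-zero (suc n) k u) ⟩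
    + (k !) * (+ c + S) - + (k !) * + c                        ≡⟨ cancel (+ (k !)) (+ c) S ⟩
    + (k !) * S                                                ≡⟨ *-distribˡ-Σ< (suc n) (+ (k !)) (λ j → expansionTerm (suc n) k u (suc j)) ⟩
    Σ< (suc n) (λ j → + (k !) * expansionTerm (suc n) k u (suc j)) ∎
    where
    c = suc n C suc k
    S = Σ< (suc n) (λ j → expansionTerm (suc n) k u (suc j))
    cancel : ∀ f c S → f * (c + S) - f * c ≡ f * S
    cancel = solve-∀

  p^ℓ∣k!*expansionTerm : ∀ {p ℓ n u} → Prime p → p ℕ.^ ℓ ℕ.∣ suc n → + p ∣ u →
                         ∀ k j → + (p ℕ.^ ℓ) ∣ + (k !) * expansionTerm (suc n) k u (suc j)
  p^ℓ∣k!*expansionTerm {p} {ℓ} {n} {u} p-prime p^ℓ∣n p∣u k j = ∣-trans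
    (∣ᵤ⇒∣ (p^ℓ∣[n+1]⇒p^ℓ∣k!*[k+J]Ck*[n+1]C[k+J+1]*p^J {ℓ = ℓ} {k = k} {J = J} p-prime p^ℓ∣n (s≤s z≤n)))
    (subst₂ _∣_ (sym coefficient≡) (*-assoc (+ (k !)) (+ a * + b) (u ^ J)) (*-monoʳ-∣ (+ (k !) * (+ a * + b)) (^-monoˡ-∣ J p∣u)))
    where
    J = suc j
    a = (k ℕ.+ J) C k
    b = suc n C suc (k ℕ.+ J)
    coefficient≡ : + (k ! ℕ.* a ℕ.* b ℕ.* p ℕ.^ J) ≡ + (k !) * (+ a * + b) * (+ p) ^ J
    coefficient≡ = begin
      + (k ! ℕ.* a ℕ.* b ℕ.* p ℕ.^ J)             ≡⟨ pos-* (k ! ℕ.* a ℕ.* b) (p ℕ.^ J) ⟩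
      + (k ! ℕ.* a ℕ.* b) * + (p ℕ.^ J)           ≡⟨ cong₂ _*_ (trans (cong +_ (ℕ.*-assoc (k !) a b)) (trans (pos-* (k !) (a ℕ.* b)) (cong (+ (k !) *_) (pos-* a b)))) (pos-^ p J) ⟩
      + (k !) * (+ a * + b) * (+ p) ^ J             ∎

  p^ℓ∣lhsSum-k!*[n+1]C[k+1] : ∀ {p ℓ n} α k → Prime p → p ℕ.^ ℓ ℕ.∣ suc n → + p ∣ α - 1ℤ →
                              p ℕ.^ ℓ ℕ.∣ ∣ lhsSum (suc n) k α - + (k ! ℕ.* (suc n C suc k)) ∣
  p^ℓ∣lhsSum-k!*[n+1]C[k+1] {p} {ℓ} {n} α k p-prime p^ℓ∣n p∣α-1 = ∣⇒∣ᵤ (subst (+ (p ℕ.^ ℓ) ∣_) (sym difference≡Σ)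
    (∣-Σ< (suc n) (p^ℓ∣k!*expansionTerm {ℓ = ℓ} p-prime p^ℓ∣n p∣α-1 k)))
    where
    α≡1+[α-1] : ∀ α → α ≡ 1ℤ + (α - 1ℤ)
    α≡1+[α-1] = solve-∀
    difference≡Σ : lhsSum (suc n) k α - + (k ! ℕ.* (suc n C suc k))
                   ≡ Σ< (suc n) (λ j → + (k !) * expansionTerm (suc n) k (α - 1ℤ) (suc j))
    difference≡Σ = trans (cong (λ a → lhsSum (suc n) k a - + (k ! ℕ.* (suc n C suc k))) (α≡1+[α-1] α))
                         (lhsSum-k!*[n+1]C[k+1]≡Σk!*expansionTerm n k (α - 1ℤ))

open import Defs
open import Data.Nat using (ℕ; suc; _∸_; _≤_)
open import Data.Nat.Primality using (Prime)
open import Data.Integer using (ℤ; +_; _-_; _*_)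
open import Data.Integer.Divisibility using (_∣_)
open import Data.Rational using (_/_)
import Data.Nat as ℕ
open import Data.Nat.Base using (_!; nonTrivial⇒n>1)
open import Data.Nat.Combinatorics using (_C_)
open import Data.Nat.Primality using (prime⇒nonTrivial)
open import Data.Integer.Divisibility.Signed using (∣ᵤ⇒∣)
open import Data.Integer.Base using (∣_∣)
import Data.Nat.Divisibility as ℕ
import Data.Rational as ℚ
open import Data.Sum using (inj₂)
open import Data.Product using (_,_)
open RationalEmbedding using (toℚ-sub-/; valGe-toℚ)
open FallingFactorialSum using (fall*[n+1]≡[k+1]*k!*[n+1]C[k+1]; p^ℓ∣lhsSum-k!*[n+1]C[k+1])

lemma2 : (k n p : ℕ) → 1 ≤ n → Prime p → (α : ℤ) → (+ p) ∣ (α - + 1) →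
    (ℓ : ℕ) → HasVal p n ℓ →
    CongQ p ℓ (toℚ (lhsSum n k α)) ((fall (+ (n ∸ 1)) k * + n) / suc k)
lemma2 k (suc n) p _ p-prime α p∣α-1 ℓ (p^ℓ∣n , _) =
  inj₂ (subst (λ q → ValGe p q ℓ) (sym difference≡toℚD) (valGe-toℚ {ℓ = ℓ} 1<p D p^ℓ∣D))
  where
  L = lhsSum (suc n) k α
  T = + (k ! ℕ.* (suc n C suc k))
  D = L - T
  1<p : 1 ℕ.< p
  1<p = nonTrivial⇒n>1 p {{prime⇒nonTrivial p-prime}}
  difference≡toℚD : toℚ L ℚ.- (fall (+ n) k * + suc n) / suc k ≡ toℚ D
  difference≡toℚD = trans (cong (λ r → toℚ L ℚ.- r / suc k) (fall*[n+1]≡[k+1]*k!*[n+1]C[k+1] n k)) (toℚ-sub-/ L T k)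
  p^ℓ∣D : p ℕ.^ ℓ ℕ.∣ ∣ D ∣
  p^ℓ∣D = p^ℓ∣lhsSum-k!*[n+1]C[k+1] {ℓ = ℓ} α k p-prime p^ℓ∣n (∣ᵤ⇒∣ p∣α-1)
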